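{- Let $<$ be a relation on a type $A$. If lists $l,k:\mathsf{List}\,A$ are both $<^L$-accessible, then so is their concatenation $l::k$.
   Context: Homotopy type theory setting; relations are arbitrary type families. For a relation $<$ on $A$, the relation $<^L$ on $\mathsf{List}\,A$ is inductively generated by: if $k:\mathsf{List}\,A$, $x:A$ and every element $y$ of $k$ satisfies $y<x$, then $(l_1::k::l_3)<^L(l_1::[x]::l_3)$ for all lists $l_1,l_3$ (i.e. $k<^Ll$ means $k$ arises from $l$ by replacing one element $x$ by finitely many elements each smaller than $x$). $::$ is list concatenation. $\mathsf{acc}^<$ is inductively generated by $\mathsf{step}:(\Pi x.(x<a)\to\mathsf{acc}^<(x))\to\mathsf{acc}^<(a)$. -}

module Defs where

open import Level using (Level; _⊔_)
open import Data.List using (List; _∷_; []; _++_)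
open import Data.List.Relation.Unary.All using (All)
open import Relation.Binary.Core using (Rel)

-- The multiset-style extension <^L of a relation _<_ on A to lists:
-- (l₁ ++ k ++ l₃) <^L (l₁ ++ [x] ++ l₃) whenever every element y of k satisfies y < x.
data _<ᴸ_ {a ℓ : Level} {A : Set a} {_<_ : Rel A ℓ} : Rel (List A) (a ⊔ ℓ) where
  replace : (l₁ k l₃ : List A) (x : A) → All (λ y → y < x) k →
            _<ᴸ_ {_<_ = _<_} (l₁ ++ k ++ l₃) (l₁ ++ (x ∷ []) ++ l₃)

ListExt : {a ℓ : Level} {A : Set a} → Rel A ℓ → Rel (List A) (a ⊔ ℓ)
ListExt _<_ = _<ᴸ_ {_<_ = _<_}

module Submission where

-- Idea: a single <ᴸ-step replaces one element x of l ++ k by smaller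
-- elements, and that x lies either in l or in k.  Hence every step into
-- l ++ k is either a step l' <ᴸ l performed inside the left part, or a
-- step k' <ᴸ k performed inside the right part.

open import Defs
open import Level using (Level; _⊔_)
open import Data.List using (List; _++_; _∷_; [])
open import Data.List.Properties using (∷-injective; ++-assoc)
open import Data.List.Relation.Unary.All using (All)
open import Data.Product using (_,_)
open import Relation.Binary.Core using (Rel)
open import Relation.Binary.PropositionalEquality using (_≡_; refl; subst)
open import Induction.WellFounded using (Acc; acc)

data AppendStep {a r : Level} {A : Set a} (_≺_ : Rel (List A) r) (l k : List A)
                : List A → Set (a ⊔ r) where
  stepˡ : ∀ {l'} → l' ≺ l → AppendStep _≺_ l k (l' ++ k)
  stepʳ : ∀ {k'} → k' ≺ k → AppendStep _≺_ l k (l ++ k')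

module _ {a r : Level} {A : Set a} {_≺_ : Rel (List A) r} where

  -- A step on the left
  -- decreases the first accessibility proof, a step on the right the
  -- second one, so structural recursion on the pair terminates.
  acc-++ : (∀ {l k m} → m ≺ (l ++ k) → AppendStep _≺_ l k m) →
           ∀ {l k} → Acc _≺_ l → Acc _≺_ k → Acc _≺_ (l ++ k)
  acc-++ decompose {l} {k} (acc rl) (acc rk) = acc λ m≺l++k → from (decompose m≺l++k)
    where
    from : ∀ {m} → AppendStep _≺_ l k m → Acc _≺_ m
    from (stepˡ l'≺l) = acc-++ decompose (rl l'≺l) (acc rk)
    from (stepʳ k'≺k) = acc-++ decompose (acc rl) (rk k'≺k)

module _ {a ℓ : Level} {A : Set a} {_<_ : Rel A ℓ} where

  ∷-step : ∀ {l' l} (y : A) → ListExt _<_ l' l → ListExt _<_ (y ∷ l') (y ∷ l)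
  ∷-step y (replace l₁ ks l₃ x ks<x) = replace (y ∷ l₁) ks l₃ x ks<x

  ∷-append-step : ∀ {l k m} (y : A) → AppendStep (ListExt _<_) l k m →
                  AppendStep (ListExt _<_) (y ∷ l) k (y ∷ m)
  ∷-append-step y (stepˡ l'<l) = stepˡ (∷-step y l'<l)
  ∷-append-step y (stepʳ k'<k) = stepʳ k'<k

  -- When x is
  -- the head of l ≢ [], the result (ks ++ l) ++ k is re-associated.
  replace-in-++ : ∀ l₁ ks l₃ x → All (_< x) ks → ∀ l k → l₁ ++ x ∷ l₃ ≡ l ++ k →
                  AppendStep (ListExt _<_) l k (l₁ ++ ks ++ l₃)
  replace-in-++ l₁ ks l₃ x ks<x [] _ refl = stepʳ (replace l₁ ks l₃ x ks<x)
  replace-in-++ [] ks l₃ x ks<x (y ∷ l) k e with ∷-injective e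
  ... | refl , refl = subst (AppendStep (ListExt _<_) (x ∷ l) k) (++-assoc ks l k)
                            (stepˡ (replace [] ks l x ks<x))
  replace-in-++ (_ ∷ l₁) ks l₃ x ks<x (y ∷ l) k e with ∷-injective e
  ... | refl , e′ = ∷-append-step y (replace-in-++ l₁ ks l₃ x ks<x l k e′)

  <ᴸ-append-step : ∀ {l k m} → ListExt _<_ m (l ++ k) → AppendStep (ListExt _<_) l k m
  <ᴸ-append-step {l} {k} m<l++k = from m<l++k refl
    where
    from : ∀ {m n} → ListExt _<_ m n → n ≡ l ++ k → AppendStep (ListExt _<_) l k m
    from (replace l₁ ks l₃ x ks<x) = replace-in-++ l₁ ks l₃ x ks<x l k

lemma5p3 : {a ℓ : Level} {A : Set a} (_<_ : Rel A ℓ) (l k : List A) →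
    Acc (ListExt _<_) l → Acc (ListExt _<_) k → Acc (ListExt _<_) (l ++ k)
lemma5p3 _<_ l k = acc-++ (<ᴸ-append-step {_<_ = _<_})
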